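{- Let $G$ be an $\alpha_1$-metric graph and let $D(u,r_u),D(v,r_v),D(w,r_w)$ be pairwise intersecting disks of $G$ such that $d(u,v)=r_u+r_v$. Then every vertex $x\in S_{r_u}(u,v)$ satisfies $d(w,x)\le r_w+2$.
   Context: All graphs are finite, undirected, unweighted, simple and connected; $d$ is the shortest-path distance, $I(u,v)=\{z : d(u,v)=d(u,z)+d(z,v)\}$, $D(v,r)=\{z: d(v,z)\le r\}$ for nonnegative integers $r$, and for $0\le k\le d(u,v)$ the slice is $S_k(u,v)=\{x\in I(u,v): d(u,x)=k\}$. A graph is $\alpha_1$-metric if for all vertices $u,v,w,x$ with $v\in I(u,w)$, $w\in I(v,x)$ and $v,w$ adjacent, $d(u,x)\ge d(u,v)+d(v,x)-1$. -}

module Defs where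

open import Data.Nat using (ℕ; zero; suc; _+_; _≤_)
open import Data.Fin using (Fin)
open import Data.Product using (_×_; Σ; ∃)
open import Relation.Binary.PropositionalEquality using (_≡_)
open import Relation.Nullary using (¬_)

record Graph (n : ℕ) : Set₁ where
  field
    Adj     : Fin n → Fin n → Set
    symAdj  : ∀ {u v} → Adj u v → Adj v u
    irrefl  : ∀ {u} → ¬ Adj u u

open Graph public

data Walk {n : ℕ} (G : Graph n) : Fin n → Fin n → ℕ → Set where
  nil  : ∀ {u} → Walk G u u 0
  cons : ∀ {u w v k} → Adj G u w → Walk G w v k → Walk G u v (suc k)

-- d is the shortest-path distance of G (its existence as a total function
-- encodes connectedness; it is unique when it exists).
IsDistance : {n : ℕ} → Graph n → (Fin n → Fin n → ℕ) → Set
IsDistance G d = ∀ u v → Walk G u v (d u v) × (∀ k → Walk G u v k → d u v ≤ k)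

module Metric {n : ℕ} (d : Fin n → Fin n → ℕ) where

  InInterval : Fin n → Fin n → Fin n → Set
  InInterval u v z = d u v ≡ d u z + d z v

  InDisk : Fin n → ℕ → Fin n → Set
  InDisk v r z = d v z ≤ r

  InSlice : ℕ → Fin n → Fin n → Fin n → Set
  InSlice k u v x = InInterval u v x × d u x ≡ k

  DisksIntersect : Fin n → ℕ → Fin n → ℕ → Set
  DisksIntersect u r v s = ∃ λ z → InDisk u r z × InDisk v s z

-- α₁-metric: d(u,x) ≥ d(u,v) + d(v,x) - 1, written without truncated subtraction.
Alpha1Metric : {n : ℕ} → Graph n → (Fin n → Fin n → ℕ) → Set
Alpha1Metric {n} G d = ∀ u v w x →
  InInterval u w v → InInterval v x w → Adj G v w →
  d u v + d v x ≤ suc (d u x)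
  where open Metric d

{-# OPTIONS --safe #-}
module Submission where

-- Let y be a neighbour of x one step closer to w. If y is farther than x from u, then α₁
-- on the edge xy, with u behind x and w behind y, gives d(u,x) + d(x,w) ≤ d(u,w) + 1,
-- so d(w,x) ≤ rw + 1; likewise for v. Otherwise y lies in the same slice S_ru(u,v) as x,
-- and then x and y have a common neighbour p in S_(ru-1)(u,v). As d(w,p) is d(w,y) or
-- d(w,x), α₁ on the edge xp (seen from v) or on the edge py (seen from u) finishes.

open import Defs
open import Data.Nat using (ℕ; zero; suc; _+_; _≤_; z≤n; s≤s; s≤s⁻¹)
open import Data.Nat.Properties
open import Data.Fin using (Fin)
open import Data.Product using (_×_; _,_; proj₁; proj₂; ∃)
open import Data.Sum using (_⊎_; inj₁; inj₂)
open import Data.Empty using (⊥-elim)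
open import Relation.Binary.PropositionalEquality
  using (_≡_; refl; sym; trans; cong; cong₂; subst; subst₂; module ≡-Reasoning)

+-squeeze : ∀ {p q a b} → p + q ≤ a + b → a ≤ p → b ≤ q → a ≡ p × b ≡ q
+-squeeze {p} {q} {a} {b} h a≤p b≤q =
  ≤-antisym a≤p (+-cancelʳ-≤ q p a (≤-trans h (+-monoʳ-≤ a b≤q))) ,
  ≤-antisym b≤q (+-cancelˡ-≤ p q b (≤-trans h (+-monoˡ-≤ b a≤p)))

≤suc⇒≡∨≡suc : ∀ {m a} → m ≤ a → a ≤ suc m → a ≡ m ⊎ a ≡ suc m
≤suc⇒≡∨≡suc m≤a a≤1+m with m≤n⇒m<n∨m≡n a≤1+m
... | inj₁ a<1+m = inj₁ (≤-antisym (s≤s⁻¹ a<1+m) m≤a)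
... | inj₂ a≡1+m = inj₂ a≡1+m

module Walks {n : ℕ} (G : Graph n) where

  _++ʷ_ : ∀ {a b c k l} → Walk G a b k → Walk G b c l → Walk G a c (k + l)
  nil      ++ʷ q = q
  cons e p ++ʷ q = cons e (p ++ʷ q)

  snocʷ : ∀ {a b c k} → Walk G a b k → Adj G b c → Walk G a c (suc k)
  snocʷ nil        e = cons e nil
  snocʷ (cons f p) e = cons f (snocʷ p e)

  reverseʷ : ∀ {a b k} → Walk G a b k → Walk G b a k
  reverseʷ nil        = nil
  reverseʷ (cons e p) = snocʷ (reverseʷ p) (symAdj G e)

module ShortestPaths {n : ℕ} (G : Graph n) (d : Fin n → Fin n → ℕ) (isD : IsDistance G d) where
  open Walks G

  geodesic : ∀ a b → Walk G a b (d a b)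
  geodesic a b = proj₁ (isD a b)

  d-min : ∀ {a b k} → Walk G a b k → d a b ≤ k
  d-min {a} {b} {k} = proj₂ (isD a b) k

  d-refl : ∀ a → d a a ≡ 0
  d-refl a = n≤0⇒n≡0 (d-min nil)

  d-sym : ∀ a b → d a b ≡ d b a
  d-sym a b = ≤-antisym (d-min (reverseʷ (geodesic b a))) (d-min (reverseʷ (geodesic a b)))

  d-triangle : ∀ a b c → d a c ≤ d a b + d b c
  d-triangle a b c = d-min (geodesic a b ++ʷ geodesic b c)

  d≡0⇒≡ : ∀ {a b} → d a b ≡ 0 → a ≡ b
  d≡0⇒≡ {a} {b} eq with subst (Walk G a b) eq (geodesic a b)
  ... | nil = refl

  adj⇒d≡1 : ∀ {a b} → Adj G a b → d a b ≡ 1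
  adj⇒d≡1 {a} {b} e with d a b in eq | d-min (cons e nil)
  ... | zero        | _ = ⊥-elim (irrefl G (subst (Adj G a) (sym (d≡0⇒≡ eq)) e))
  ... | suc zero    | _ = refl
  ... | suc (suc _) | s≤s ()

  d-lipschitzˡ : ∀ {a b} c → Adj G a b → d a c ≤ suc (d b c)
  d-lipschitzˡ {a} {b} c e = subst (λ k → d a c ≤ k + d b c) (adj⇒d≡1 e) (d-triangle a b c)

  d-lipschitzʳ : ∀ {a b} c → Adj G a b → d c a ≤ suc (d c b)
  d-lipschitzʳ {a} {b} c e =
    subst₂ _≤_ (d-sym a c) (cong suc (d-sym b c)) (d-lipschitzˡ c e)

  step-towards : ∀ {a b m} → d a b ≡ suc m → ∃ λ c → Adj G a c × d c b ≡ m
  step-towards {a} {b} eq with subst (Walk G a b) eq (geodesic a b)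
  ... | cons {w = c} e p =
    c , e , ≤-antisym (d-min p) (s≤s⁻¹ (subst (_≤ suc (d c b)) eq (d-lipschitzˡ b e)))

  d≡1⇒adj : ∀ {a b} → d a b ≡ 1 → Adj G a b
  d≡1⇒adj eq with step-towards eq
  ... | c , e , cb = subst (Adj G _) (d≡0⇒≡ cb) e

  last-step : ∀ a b → d a b ≡ 0 ⊎ ∃ λ c → Adj G c b × d a b ≡ suc (d a c)
  last-step a b with d a b in eq
  ... | zero  = inj₁ refl
  ... | suc m with step-towards (trans (d-sym b a) eq)
  ...   | c , e , cb = inj₂ (c , symAdj G e , cong suc (sym (trans (d-sym a c) cb)))

  d-across-edges : ∀ {a b c e m} → Adj G a c → Adj G e b → d a e ≡ suc m → d c b ≡ m →
                   d c e ≡ m ⊎ d c e ≡ suc m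
  d-across-edges {c = c} {e} ac eb ae cb = ≤suc⇒≡∨≡suc
    (s≤s⁻¹ (subst (_≤ suc (d c e)) ae (d-lipschitzˡ e ac)))
    (subst (λ k → d c e ≤ suc k) cb (d-lipschitzʳ c eb))

  disks-intersect⇒d≤ : ∀ {a b r s} → Metric.DisksIntersect d a r b s → d a b ≤ r + s
  disks-intersect⇒d≤ {a} {b} (z , az , bz) =
    ≤-trans (d-triangle a z b) (+-mono-≤ az (subst (_≤ _) (d-sym b z) bz))

module Alpha1 {n : ℕ} (G : Graph n) (d : Fin n → Fin n → ℕ) (isD : IsDistance G d)
              (α₁ : Alpha1Metric G d) where
  open ShortestPaths G d isD

  α₁-edge : ∀ {a b c e} → Adj G b c → d a c ≡ suc (d a b) → d e b ≡ suc (d e c) →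
            d a b + d e b ≤ suc (d a e)
  α₁-edge {a} {b} {c} {e} bc ac eb =
    subst (λ k → d a b + k ≤ suc (d a e)) (d-sym b e) (α₁ a b c e b∈I[a,c] c∈I[b,e] bc)
    where
    open ≡-Reasoning
    b∈I[a,c] : d a c ≡ d a b + d b c
    b∈I[a,c] = begin
      d a c         ≡⟨ ac ⟩
      suc (d a b)   ≡⟨ +-comm 1 (d a b) ⟩
      d a b + 1     ≡⟨ cong (d a b +_) (adj⇒d≡1 bc) ⟨
      d a b + d b c ∎
    c∈I[b,e] : d b e ≡ d b c + d c e
    c∈I[b,e] = begin
      d b e         ≡⟨ d-sym b e ⟩
      d e b         ≡⟨ eb ⟩
      suc (d e c)   ≡⟨ cong suc (d-sym e c) ⟩
      1 + d c e     ≡⟨ cong (_+ d c e) (adj⇒d≡1 bc) ⟨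
      d b c + d c e ∎

  α₁-edge-bound : ∀ {a b c e r s} → Adj G b c → d a c ≡ suc (d a b) → d e b ≡ suc (d e c) →
                  d a b ≡ r → d a e ≤ r + s → d e b ≤ suc s
  α₁-edge-bound {a} {b} {e = e} {r} {s} bc ac eb ab ae = +-cancelˡ-≤ r (d e b) (suc s) (begin
    r + d e b      ≡⟨ cong (_+ d e b) ab ⟨
    d a b + d e b  ≤⟨ α₁-edge bc ac eb ⟩
    suc (d a e)    ≤⟨ s≤s ae ⟩
    suc (r + s)    ≡⟨ +-suc r s ⟨
    r + suc s      ∎)
    where open ≤-Reasoning

  common-neighbour : ∀ {x y v r} → Adj G x y → d v x ≡ r → d v y ≡ r →
    ∀ s z → d z x ≡ suc s → d z y ≡ suc s → d v z ≡ suc s + r →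
    ∃ λ p → Adj G p x × Adj G p y × d z p ≡ s × d v p ≡ suc r
  common-neighbour xy vx vy zero z zx zy vz = z , d≡1⇒adj zx , d≡1⇒adj zy , d-refl z , vz
  common-neighbour {x} {y} {v} {r} xy vx vy (suc t) z zx zy vz =
    from-first-steps (step-towards zx) (step-towards zy)
    where
    nearer : ∀ {c a} → Adj G z c → d v a ≡ r → d c a ≡ suc t → d v c ≡ suc t + r
    nearer {c} {a} zc va ca = ≤-antisym
      (begin
        d v c          ≤⟨ d-triangle v a c ⟩
        d v a + d a c  ≡⟨ cong₂ _+_ va (trans (d-sym a c) ca) ⟩
        r + suc t      ≡⟨ +-comm r (suc t) ⟩
        suc t + r      ∎)
      (s≤s⁻¹ (subst (_≤ suc (d v c)) vz (d-lipschitzʳ v zc)))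
      where open ≤-Reasoning

    descend : ∀ {c} → Adj G z c → d c x ≡ suc t → d c y ≡ suc t → d v c ≡ suc t + r →
              ∃ λ p → Adj G p x × Adj G p y × d z p ≡ suc t × d v p ≡ suc r
    descend {c} zc cx cy vc with common-neighbour xy vx vy t c cx cy vc
    ... | p , px , py , cp , vp = p , px , py , zp , vp
      where
      zp : d z p ≡ suc t
      zp = ≤-antisym
        (subst (λ k → d z p ≤ suc k) cp (d-lipschitzˡ p zc))
        (s≤s⁻¹ (subst (_≤ suc (d z p)) zx (d-lipschitzʳ z (symAdj G px))))

    from-first-steps : (∃ λ c → Adj G z c × d c x ≡ suc t) → (∃ λ c → Adj G z c × d c y ≡ suc t) →
              ∃ λ p → Adj G p x × Adj G p y × d z p ≡ suc t × d v p ≡ suc r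
    from-first-steps (z' , zz' , z'x) (y' , zy' , y'y)
      with d-across-edges zz' (symAdj G xy) zy z'x | d-across-edges zy' xy zx y'y
    ... | inj₁ z'y | _        = descend zz' z'x z'y (nearer zz' vx z'x)
    ... | inj₂ _   | inj₁ y'x = descend zy' y'x y'y (nearer zy' vy y'y)
    -- Here α₁ on the edge xy forces d(z',y') = 2, and then α₁ on the edge zz' puts y'
    -- farther from v than y is.
    ... | inj₂ z'y | inj₂ y'x = ⊥-elim (1+n≰n (s≤s⁻¹ (begin
        suc (suc (suc t + r))  ≡⟨ cong₂ _+_ (adj⇒d≡1 (symAdj G zy')) vz ⟨
        d y' z + d v z         ≤⟨ α₁-edge zz' z∈I[y',z'] z'∈I[z,v] ⟩
        suc (d y' v)           ≡⟨ cong suc (trans (d-sym y' v) (nearer zy' vy y'y)) ⟩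
        suc (suc t + r)        ∎)))
      where
      open ≤-Reasoning
      z'y'≤2 : d z' y' ≤ 2
      z'y'≤2 = subst (λ k → d z' y' ≤ suc k) (adj⇒d≡1 zy') (d-lipschitzˡ y' (symAdj G zz'))
      2≤z'y' : 2 ≤ d z' y'
      2≤z'y' = s≤s⁻¹ (begin
        3                      ≤⟨ s≤s (≤-trans (s≤s (s≤s z≤n)) (m≤n+m (suc (suc t)) t)) ⟩
        suc t + suc (suc t)    ≡⟨ cong₂ _+_ z'x y'x ⟨
        d z' x + d y' x        ≤⟨ α₁-edge xy (trans z'y (cong suc (sym z'x)))
                                             (trans y'x (cong suc (sym y'y))) ⟩
        suc (d z' y')          ∎)
      z∈I[y',z'] : d y' z' ≡ suc (d y' z)
      z∈I[y',z'] = trans (d-sym y' z') (trans (≤-antisym z'y'≤2 2≤z'y')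
                 (cong suc (sym (adj⇒d≡1 (symAdj G zy')))))
      z'∈I[z,v] : d v z ≡ suc (d v z')
      z'∈I[z,v] = trans vz (cong suc (sym (nearer zz' vx z'x)))

  slice-edge-bound : ∀ {u v w x y} ru {rv rw} →
    d u v ≡ ru + rv → d u w ≤ ru + rw → d v w ≤ rv + rw → Adj G x y →
    d u x ≡ ru → d u y ≡ ru → d v x ≡ rv → d v y ≡ rv → d w x ≡ suc (d w y) → d w x ≤ 2 + rw
  slice-edge-bound {x = x} zero _ _ _ xy ux uy _ _ _ =
    ⊥-elim (irrefl G (subst (Adj G x) (trans (sym (d≡0⇒≡ uy)) (d≡0⇒≡ ux)) xy))
  slice-edge-bound {u} {v} {w} (suc k) {rw = rw} uv uw vw xy ux uy vx vy wx
    with common-neighbour xy vx vy k u ux uy (trans (d-sym v u) uv)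
  ... | p , px , py , up , vp
    with ≤suc⇒≡∨≡suc (s≤s⁻¹ (subst (_≤ suc (d w p)) wx (d-lipschitzʳ w (symAdj G px))))
                      (d-lipschitzʳ w py)
  ...   | inj₁ wp = m≤n⇒m≤1+n
          (α₁-edge-bound (symAdj G px) (trans vp (cong suc (sym vx)))
                         (trans wx (cong suc (sym wp))) vx vw)
  ...   | inj₂ wp = subst (_≤ 2 + rw) (trans wp (sym wx))
          (α₁-edge-bound py (trans uy (cong suc (sym up))) wp up
                         (subst (d u w ≤_) (sym (+-suc k rw)) uw))

  slice-bound : ∀ {u v w x} ru rv rw →
    d u v ≡ ru + rv → d u w ≤ ru + rw → d v w ≤ rv + rw → d u x ≡ ru → d v x ≡ rv → d w x ≤ 2 + rw
  slice-bound {u} {v} {w} {x} ru rv rw uv uw vw ux vx with last-step w x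
  ... | inj₁ wx≡0 = subst (_≤ 2 + rw) (sym wx≡0) z≤n
  ... | inj₂ (y , yx , wx)
    with m≤n⇒m<n∨m≡n (d-lipschitzʳ u yx) | m≤n⇒m<n∨m≡n (d-lipschitzʳ v yx)
  ...   | inj₂ uy  | _        = m≤n⇒m≤1+n (α₁-edge-bound (symAdj G yx) uy wx ux uw)
  ...   | inj₁ _   | inj₂ vy  = m≤n⇒m≤1+n (α₁-edge-bound (symAdj G yx) vy wx vx vw)
  ...   | inj₁ uy< | inj₁ vy< =
          slice-edge-bound ru uv uw vw (symAdj G yx) ux (proj₁ y∈slice) vx (proj₂ y∈slice) wx
    where
    open ≤-Reasoning
    y∈slice : d u y ≡ ru × d v y ≡ rv
    y∈slice = +-squeeze
      (begin
        ru + rv        ≡⟨ uv ⟨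
        d u v          ≤⟨ d-triangle u y v ⟩
        d u y + d y v  ≡⟨ cong (d u y +_) (d-sym y v) ⟩
        d u y + d v y  ∎)
      (subst (d u y ≤_) ux (s≤s⁻¹ uy<))
      (subst (d v y ≤_) vx (s≤s⁻¹ vy<))

lemma16 : ∀ {n} (G : Graph n) (d : Fin n → Fin n → ℕ) →
    IsDistance G d → Alpha1Metric G d →
    ∀ (u v w : Fin n) (ru rv rw : ℕ) →
    Metric.DisksIntersect d u ru v rv →
    Metric.DisksIntersect d u ru w rw →
    Metric.DisksIntersect d v rv w rw →
    d u v ≡ ru + rv →
    ∀ x → Metric.InSlice d ru u v x → d w x ≤ rw + 2
-- The hypothesis that D(u,ru) and D(v,rv) meet is implied by d(u,v) = ru + rv.
lemma16 G d isD α₁ u v w ru rv rw _ Duw Dvw uv x (x∈I[u,v] , ux) =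
  subst (d w x ≤_) (+-comm 2 rw)
    (slice-bound ru rv rw uv (disks-intersect⇒d≤ Duw) (disks-intersect⇒d≤ Dvw) ux vx)
  where
  open Alpha1 G d isD α₁
  open ShortestPaths G d isD
  open ≡-Reasoning
  vx : d v x ≡ rv
  vx = trans (d-sym v x) (+-cancelˡ-≡ ru (d x v) rv (begin
    ru + d x v     ≡⟨ cong (_+ d x v) ux ⟨
    d u x + d x v  ≡⟨ x∈I[u,v] ⟨
    d u v          ≡⟨ uv ⟩
    ru + rv        ∎))
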